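{- For all nonnegative integers $k,n$, $a_{k,n}$ equals the number of pairs $(c_1,c_2)$, where $c_1$ is an ordered composition of $k+1$ into odd summands and $c_2$ is an ordered composition of $n+1$ into odd summands, such that $c_1$ and $c_2$ have the same number of summands.
   Context: For nonnegative integers $k,n$, let $a_{k,n}$ be the number of ways to partition a set consisting of $k$ marked points on a line and $n$ marked points on a parallel line into pairs, joining the two points of each pair by a straight segment, such that no two segments have a common point (in particular, no endpoint lies on another segment). We have $a_{0,0}=1$. A composition of $m$ is a representation of $m$ as an ordered sum of positive integers. Sums differing in the order of the summands are considered different. -}

module Defs where

open import Data.Bool using (Bool; true; false; _∧_; _∨_; not; if_then_else_)
open import Data.Nat using (ℕ; zero; suc; _+_; _<ᵇ_; _≡ᵇ_; _%_)
open import Data.Fin using (Fin; toℕ)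
open import Data.Vec using (Vec; []; _∷_; lookup)
open import Data.List using (List; []; _∷_; [_]; map; concatMap; filter; length; upTo; allFin; cartesianProduct)
open import Data.Nat.ListAction using (sum)
open import Data.Product using (_×_; _,_)

boolFilter : ∀ {A : Set} → (A → Bool) → List A → List A
boolFilter p []       = []
boolFilter p (x ∷ xs) = if p x then x ∷ boolFilter p xs else boolFilter p xs

allᵇ : ∀ {A : Set} → (A → Bool) → List A → Bool
allᵇ p []       = true
allᵇ p (x ∷ xs) = p x ∧ allᵇ p xs

vecs : (m l : ℕ) → List (Vec (Fin m) l)
vecs m zero    = [ [] ]
vecs m (suc l) = concatMap (λ x → map (x ∷_) (vecs m l)) (allFin m)

-- Non-crossing pairings of k points on one line and n on a parallel line.
--
-- The k + n points are indexed by Fin (k + n): index i < k is the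
-- (i+1)-st point on the first line, index k + j is the (j+1)-st point on
-- the second line (both lines ordered in the same direction).
-- A partition into pairs is encoded by its fixed-point-free involution
-- f = lookup v, stored as a vector v (so distinct partitions are distinct
-- vectors).

module _ (k n : ℕ) where

  Pt : Set
  Pt = Fin (k + n)

  onLine1 : Pt → Bool
  onLine1 x = toℕ x <ᵇ k

  sameLine : Pt → Pt → Bool
  sameLine x y = (onLine1 x ∧ onLine1 y) ∨ (not (onLine1 x) ∧ not (onLine1 y))

  eqᵇ : Pt → Pt → Bool
  eqᵇ x y = toℕ x ≡ᵇ toℕ y

  -- z lies strictly between x and y (as indices; only used for points
  -- on one and the same line, where this is geometric betweenness)
  between : Pt → Pt → Pt → Bool
  between x z y = ((toℕ x <ᵇ toℕ z) ∧ (toℕ z <ᵇ toℕ y)) ∨ ((toℕ y <ᵇ toℕ z) ∧ (toℕ z <ᵇ toℕ x))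

  forallPt : (Pt → Bool) → Bool
  forallPt p = allᵇ p (allFin (k + n))

  isPairing : Vec Pt (k + n) → Bool
  isPairing v = forallPt λ x → not (eqᵇ (lookup v x) x) ∧ eqᵇ (lookup v (lookup v x)) x

  -- A segment joining two points of the same line lies on that line; no
  -- marked point may lie on it (this also excludes overlaps of two such
  -- segments, and any contact with the endpoint of a segment between the
  -- lines).
  noPointOnSegment : Vec Pt (k + n) → Bool
  noPointOnSegment v = forallPt λ x → forallPt λ z →
    not (sameLine x (lookup v x) ∧ between x z (lookup v x))

  -- Segments between the two lines: x (on line 1) joined to f x (on
  -- line 2).  Two such segments have no common point iff they do not cross,
  -- i.e. iff the order of their endpoints agrees on both lines.
  isCross : Vec Pt (k + n) → Pt → Bool
  isCross v x = onLine1 x ∧ not (onLine1 (lookup v x))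

  noCrossing : Vec Pt (k + n) → Bool
  noCrossing v = forallPt λ x → forallPt λ y →
    not (isCross v x ∧ isCross v y ∧ (toℕ x <ᵇ toℕ y)
         ∧ not (toℕ (lookup v x) <ᵇ toℕ (lookup v y)))

  isValidPairing : Vec Pt (k + n) → Bool
  isValidPairing v = isPairing v ∧ noPointOnSegment v ∧ noCrossing v

a : ℕ → ℕ → ℕ
a k n = length (boolFilter (isValidPairing k n) (vecs (k + n) (k + n)))

-- Every composition of m has at most m summands, each ≤ m, so the list
-- below enumerates each of them exactly once (for m ≥ 1; for m = 0 it
-- yields just the empty composition).

isOdd : ℕ → Bool
isOdd x = x % 2 ≡ᵇ 1

vecToList : ∀ {A : Set} {l} → Vec A l → List A
vecToList []       = []
vecToList (x ∷ xs) = x ∷ vecToList xs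

isOddComposition : ℕ → List ℕ → Bool
isOddComposition m c = allᵇ isOdd c ∧ (sum c ≡ᵇ m)

oddCompositions : ℕ → List (List ℕ)
oddCompositions m =
  boolFilter (isOddComposition m)
    (concatMap (λ r → map (λ v → map toℕ (vecToList v)) (vecs (suc m) r)) (upTo (suc m)))

pairCount : ℕ → ℕ → ℕ
pairCount k n =
  length (boolFilter (λ { (c₁ , c₂) → length c₁ ≡ᵇ length c₂ })
           (cartesianProduct (oddCompositions (suc k)) (oddCompositions (suc n))))

{-# OPTIONS --safe #-}

-- In a non-crossing pairing a segment along a line can only join two neighbours, and the
-- segments between the lines join the remaining points of the first line, in order, to those
-- of the second.  Reading such a pair of neighbours as a domino and every other point as a
-- square, a pairing is the same as a pair of tilings of strips of lengths k and n by dominoes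
-- and squares with equally many squares.  The squares cut a tiling of a strip of length m
-- into runs of dominoes; reading a run of d dominoes as the odd part 2d + 1 turns the tiling
-- into an odd composition of m + 1 with one part more than there are squares.

module Submission where

open import Defs
open import Data.Bool using (Bool; true; false; T; not; _∧_)
open import Data.Bool.Properties using (T-∧)
open import Data.Nat
  using (ℕ; zero; suc; pred; _+_; _∸_; _≤_; _<_; _≮_; z≤n; s≤s; _≟_; _<?_; _<ᵇ_; _≡ᵇ_; ⌊_/2⌋)
open import Data.Nat.Properties
open import Data.Nat.ListAction using (sum)
open import Data.Fin using (Fin; toℕ; fromℕ<)
open import Data.Fin.Properties using (toℕ-injective; toℕ-fromℕ<; fromℕ<-toℕ; toℕ<n)
open import Data.Vec using (Vec; []; _∷_; lookup; tabulate)
open import Data.Vec.Properties using (∷-injectiveˡ; ∷-injectiveʳ; lookup∘tabulate; tabulate∘lookup; tabulate-cong)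
open import Data.List
  using (List; []; _∷_; [_]; _++_; map; length; drop; filterᵇ; concatMap; allFin; upTo; applyUpTo; cartesianProduct)
open import Data.List.Properties using (length-map; length-++; length-applyUpTo; map-∘; map-id-local)
import Data.List.Properties as List
open import Data.List.Relation.Unary.All as All using (All; []; _∷_)
import Data.List.Relation.Unary.All.Properties as All
open import Data.List.Relation.Unary.AllPairs as AllPairs using (AllPairs; []; _∷_)
import Data.List.Relation.Unary.AllPairs.Properties as AllPairs
open import Data.List.Relation.Unary.Any using (here; there)
import Data.List.Relation.Unary.Any as Any
open import Data.List.Relation.Unary.Unique.Propositional using (Unique)
import Data.List.Relation.Unary.Unique.Propositional.Properties as Unique
open import Data.List.Relation.Binary.Disjoint.Propositional using (Disjoint)
open import Data.List.Relation.Binary.BagAndSetEquality using (∼bag⇒↭)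
open import Data.List.Relation.Binary.Permutation.Propositional.Properties using (↭-length)
open import Data.List.Membership.Propositional using (_∈_)
open import Data.List.Membership.Propositional.Properties
  using (∈-filter⁻; ∈-filter⁺; ∈-map⁺; ∈-map⁻; ∈-concatMap⁺; ∈-allFin; ∈-upTo⁺;
         ∈-cartesianProduct⁺; ∈-cartesianProduct⁻)
open import Data.List.Membership.Propositional.Properties.WithK using (unique∧set⇒bag)
open import Data.Product as Product using (_×_; _,_; proj₁; proj₂; ∃)
open import Data.Sum using (_⊎_; inj₁; inj₂)
open import Data.Empty using (⊥; ⊥-elim)
open import Function using (_∘_; _∘′_; _⇔_; mk⇔; Equivalence; case_of_)
open import Relation.Nullary using (¬_; Dec; yes; no; contradiction; ¬?)
open import Relation.Nullary.Decidable using (T?; decidable-stable; _×-dec_; _⊎-dec_)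
open import Relation.Nullary.Reflects using (Reflects; ofʸ; ofⁿ; fromEquivalence; ¬-reflects; _×-reflects_; _⊎-reflects_)
open import Relation.Binary.Definitions using (tri<; tri≈; tri>)
open import Relation.Binary.PropositionalEquality hiding ([_])

boolFilter≡filterᵇ : ∀ {A : Set} (p : A → Bool) xs → boolFilter p xs ≡ filterᵇ p xs
boolFilter≡filterᵇ p [] = refl
boolFilter≡filterᵇ p (x ∷ xs) with p x
... | true  = cong (x ∷_) (boolFilter≡filterᵇ p xs)
... | false = boolFilter≡filterᵇ p xs

∈-boolFilter⁻ : ∀ {A : Set} (p : A → Bool) xs {x} → x ∈ boolFilter p xs → x ∈ xs × T (p x)
∈-boolFilter⁻ p xs rewrite boolFilter≡filterᵇ p xs = ∈-filter⁻ (T? ∘ p)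

∈-boolFilter⁺ : ∀ {A : Set} (p : A → Bool) xs {x} → x ∈ xs → T (p x) → x ∈ boolFilter p xs
∈-boolFilter⁺ p xs rewrite boolFilter≡filterᵇ p xs = ∈-filter⁺ (T? ∘ p)

boolFilter-unique : ∀ {A : Set} (p : A → Bool) {xs} → Unique xs → Unique (boolFilter p xs)
boolFilter-unique p {xs} rewrite boolFilter≡filterᵇ p xs = Unique.filter⁺ (T? ∘ p)

T-allᵇ : ∀ {A : Set} (p : A → Bool) xs → T (allᵇ p xs) ⇔ All (T ∘ p) xs
T-allᵇ p [] = mk⇔ (λ _ → []) (λ _ → _)
T-allᵇ p (x ∷ xs) = mk⇔
  (λ t → let (px , pxs) = Equivalence.to T-∧ t in px ∷ Equivalence.to (T-allᵇ p xs) pxs)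
  (λ { (px ∷ pxs) → Equivalence.from T-∧ (px , Equivalence.from (T-allᵇ p xs) pxs) })

concatMap-unique : ∀ {A B : Set} (f : A → List B) {xs} → Unique xs → (∀ x → Unique (f x)) →
  (∀ {x y} → x ≢ y → Disjoint (f x) (f y)) → Unique (concatMap f xs)
concatMap-unique f {xs} xs! f! disjoint =
  Unique.concat⁺ (All.map⁺ (All.universal f! xs)) (AllPairs.map⁺ (AllPairs.map disjoint xs!))

length-≡-by-inverses : ∀ {A B : Set} {xs : List A} {ys : List B} → Unique xs → Unique ys →
  (f : A → B) (g : B → A) →
  (∀ {x} → x ∈ xs → f x ∈ ys) → (∀ {y} → y ∈ ys → g y ∈ xs) →
  (∀ {x} → x ∈ xs → g (f x) ≡ x) → (∀ {y} → y ∈ ys → f (g y) ≡ y) →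
  length xs ≡ length ys
length-≡-by-inverses {xs = xs} {ys} xs! ys! f g f∈ g∈ gf fg =
  trans (sym (length-map f xs)) (↭-length (∼bag⇒↭ (unique∧set⇒bag fxs! ys! same)))
  where
  gfxs≡xs : map g (map f xs) ≡ xs
  gfxs≡xs = trans (sym (map-∘ xs)) (map-id-local (All.tabulate gf))

  fxs! : Unique (map f xs)
  fxs! = Unique.map⁻ (subst Unique (sym gfxs≡xs) xs!)

  same : ∀ {y} → y ∈ map f xs ⇔ y ∈ ys
  same = mk⇔ (λ y∈ → let (x , x∈ , y≡) = ∈-map⁻ f y∈ in subst (_∈ ys) (sym y≡) (f∈ x∈))
             (λ y∈ → subst (_∈ map f xs) (fg y∈) (∈-map⁺ f (g∈ y∈)))

∈-vecs : ∀ m l (v : Vec (Fin m) l) → v ∈ vecs m l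
∈-vecs m zero    []      = here refl
∈-vecs m (suc l) (x ∷ v) =
  ∈-concatMap⁺ _ (Any.map (λ { refl → ∈-map⁺ (x ∷_) (∈-vecs m l v) }) (∈-allFin x))

vecs-unique : ∀ m l → Unique (vecs m l)
vecs-unique m zero    = [] ∷ []
vecs-unique m (suc l) = concatMap-unique _ (Unique.allFin⁺ m)
  (λ x → Unique.map⁺ ∷-injectiveʳ (vecs-unique m l))
  (λ x≢y (u∈ , w∈) → x≢y (head≡ u∈ w∈))
  where
  head≡ : ∀ {x y : Fin m} {u} → u ∈ map (x ∷_) (vecs m l) → u ∈ map (y ∷_) (vecs m l) → x ≡ y
  head≡ u∈ w∈ with ∈-map⁻ _ u∈ | ∈-map⁻ _ w∈
  ... | _ , _ , refl | _ , _ , eq = ∷-injectiveˡ eq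

Odd : ℕ → Set
Odd = T ∘ isOdd

toℕs : ∀ {m l} → Vec (Fin m) l → List ℕ
toℕs v = map toℕ (vecToList v)

length-toℕs : ∀ {m l} (v : Vec (Fin m) l) → length (toℕs v) ≡ l
length-toℕs []      = refl
length-toℕs (x ∷ v) = cong suc (length-toℕs v)

toℕs-injective : ∀ {m l} (u v : Vec (Fin m) l) → toℕs u ≡ toℕs v → u ≡ v
toℕs-injective []      []      _  = refl
toℕs-injective (x ∷ u) (y ∷ v) eq =
  let (x≡y , u≡v) = List.∷-injective eq in cong₂ _∷_ (toℕ-injective x≡y) (toℕs-injective u v u≡v)

fromℕs : ∀ {m} (c : List ℕ) → All (_< m) c → Vec (Fin m) (length c)
fromℕs []      []         = []
fromℕs (x ∷ c) (x<m ∷ c<m) = fromℕ< x<m ∷ fromℕs c c<m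

toℕs-fromℕs : ∀ {m} (c : List ℕ) (c<m : All (_< m) c) → toℕs (fromℕs c c<m) ≡ c
toℕs-fromℕs []      []          = refl
toℕs-fromℕs (x ∷ c) (x<m ∷ c<m) = cong₂ _∷_ (toℕ-fromℕ< x<m) (toℕs-fromℕs c c<m)

candidates : ℕ → List (List ℕ)
candidates m = concatMap (λ r → map toℕs (vecs (suc m) r)) (upTo (suc m))

candidates-unique : ∀ m → Unique (candidates m)
candidates-unique m = concatMap-unique _ (Unique.upTo⁺ (suc m))
  (λ r → Unique.map⁺ (toℕs-injective _ _) (vecs-unique (suc m) r))
  (λ r≢r' (c∈ , c∈') → r≢r' (trans (sym (length≡ c∈)) (length≡ c∈')))
  where
  length≡ : ∀ {r c} → c ∈ map toℕs (vecs (suc m) r) → length c ≡ r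
  length≡ c∈ with ∈-map⁻ _ c∈
  ... | v , _ , refl = length-toℕs v

odd⇒pos : ∀ {x} → Odd x → 0 < x
odd⇒pos {suc x} _ = s≤s z≤n

length≤sum : ∀ {c} → All Odd c → length c ≤ sum c
length≤sum []         = z≤n
length≤sum (ox ∷ oc) = +-mono-≤ (odd⇒pos ox) (length≤sum oc)

parts<suc-sum : ∀ c → All (_< suc (sum c)) c
parts<suc-sum []      = []
parts<suc-sum (x ∷ c) = s≤s (m≤m+n x (sum c))
  ∷ All.map (λ y<s → ≤-trans y<s (s≤s (m≤n+m (sum c) x))) (parts<suc-sum c)

∈-candidates : ∀ {m c} → All Odd c → sum c ≡ m → c ∈ candidates m
∈-candidates {c = c} oc refl =
  ∈-concatMap⁺ (λ r → map toℕs (vecs (suc (sum c)) r))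
    (Any.map (λ { refl → c∈ }) (∈-upTo⁺ (s≤s (length≤sum oc))))
  where
  c< = parts<suc-sum c
  c∈ : c ∈ map toℕs (vecs (suc (sum c)) (length c))
  c∈ = subst (_∈ map toℕs (vecs (suc (sum c)) (length c))) (toℕs-fromℕs c c<) (∈-map⁺ toℕs (∈-vecs _ _ _))

∈-oddCompositions : ∀ {m c} → c ∈ oddCompositions m ⇔ (All Odd c × sum c ≡ m)
∈-oddCompositions {m} {c} = mk⇔
  (λ c∈ → let (_ , t)       = ∈-boolFilter⁻ (isOddComposition m) (candidates m) c∈
              (odd , sum≡) = Equivalence.to T-∧ t
          in Equivalence.to (T-allᵇ isOdd c) odd , ≡ᵇ⇒≡ _ _ sum≡)
  (λ (oc , sum≡) → ∈-boolFilter⁺ (isOddComposition m) (candidates m) (∈-candidates oc sum≡)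
     (Equivalence.from T-∧ (Equivalence.from (T-allᵇ isOdd c) oc , ≡⇒≡ᵇ _ _ sum≡)))

oddCompositions-unique : ∀ m → Unique (oddCompositions m)
oddCompositions-unique m = boolFilter-unique (isOddComposition m) (candidates-unique m)

-- Tilings by dominoes and squares, and odd compositions

-- In a pairing, the left and right end of a segment joining neighbours on a line are the
-- halves of a domino; an endpoint of a segment between the lines is a square.
data Mark : Set where
  dominoˡ dominoʳ square : Mark

data Tiling : List Mark → Set where
  []      : Tiling []
  square∷ : ∀ {w} → Tiling w → Tiling (square ∷ w)
  domino∷ : ∀ {w} → Tiling w → Tiling (dominoˡ ∷ dominoʳ ∷ w)

#squares : List Mark → ℕ
#squares []            = 0
#squares (square ∷ w)  = suc (#squares w)
#squares (dominoˡ ∷ w) = #squares w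
#squares (dominoʳ ∷ w) = #squares w

dominoes : ℕ → List Mark
dominoes zero    = []
dominoes (suc d) = dominoˡ ∷ dominoʳ ∷ dominoes d

block : ℕ → List Mark
block c = square ∷ dominoes ⌊ c /2⌋

tilingOf : List ℕ → List Mark
tilingOf c = drop 1 (concatMap block c)

-- runs d w: the parts read off w when the current run already contains d dominoes.
runs : ℕ → List Mark → List ℕ
runs d []            = [ suc (d + d) ]
runs d (square ∷ w)  = suc (d + d) ∷ runs 0 w
runs d (dominoˡ ∷ w) = runs (suc d) w
runs d (dominoʳ ∷ w) = runs d w

compositionOf : List Mark → List ℕ
compositionOf = runs 0

⌊2d+1/2⌋≡d : ∀ d → ⌊ suc (d + d) /2⌋ ≡ d
⌊2d+1/2⌋≡d zero    = refl
⌊2d+1/2⌋≡d (suc d) rewrite +-suc d d = cong suc (⌊2d+1/2⌋≡d d)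

odd⇒2⌊c/2⌋+1≡c : ∀ {c} → Odd c → suc (⌊ c /2⌋ + ⌊ c /2⌋) ≡ c
odd⇒2⌊c/2⌋+1≡c {suc zero}          _   = refl
odd⇒2⌊c/2⌋+1≡c {suc (suc c)} odd rewrite +-suc ⌊ c /2⌋ ⌊ c /2⌋ =
  cong (suc ∘′ suc) (odd⇒2⌊c/2⌋+1≡c {c} odd)

odd-2d+1 : ∀ d → Odd (suc (d + d))
odd-2d+1 zero    = _
odd-2d+1 (suc d) rewrite +-suc d d = odd-2d+1 d

tiling-dominoes-++ : ∀ d {w} → Tiling w → Tiling (dominoes d ++ w)
tiling-dominoes-++ zero    t = t
tiling-dominoes-++ (suc d) t = domino∷ (tiling-dominoes-++ d t)

tiling-blocks : ∀ cs → Tiling (concatMap block cs)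
tiling-blocks []       = []
tiling-blocks (c ∷ cs) = square∷ (tiling-dominoes-++ ⌊ c /2⌋ (tiling-blocks cs))

tilingOf-tiling : ∀ c → Tiling (tilingOf c)
tilingOf-tiling []       = []
tilingOf-tiling (c ∷ cs) = tiling-dominoes-++ ⌊ c /2⌋ (tiling-blocks cs)

length-dominoes-++ : ∀ d w → length (dominoes d ++ w) ≡ d + d + length w
length-dominoes-++ zero    w = refl
length-dominoes-++ (suc d) w rewrite length-dominoes-++ d w | +-suc d d = refl

#squares-dominoes-++ : ∀ d w → #squares (dominoes d ++ w) ≡ #squares w
#squares-dominoes-++ zero    w = refl
#squares-dominoes-++ (suc d) w = #squares-dominoes-++ d w

length-blocks : ∀ {cs} → All Odd cs → length (concatMap block cs) ≡ sum cs
length-blocks {[]}     []          = refl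
length-blocks {c ∷ cs} (odd ∷ odds) rewrite length-dominoes-++ ⌊ c /2⌋ (concatMap block cs) =
  cong₂ _+_ (odd⇒2⌊c/2⌋+1≡c odd) (length-blocks odds)

#squares-blocks : ∀ cs → #squares (concatMap block cs) ≡ length cs
#squares-blocks []       = refl
#squares-blocks (c ∷ cs) = cong suc (trans (#squares-dominoes-++ ⌊ c /2⌋ _) (#squares-blocks cs))

runs-dominoes-++ : ∀ d e w → runs d (dominoes e ++ w) ≡ runs (d + e) w
runs-dominoes-++ d zero    w rewrite +-identityʳ d = refl
runs-dominoes-++ d (suc e) w rewrite +-suc d e = runs-dominoes-++ (suc d) e w

runs-blocks : ∀ {c cs} → All Odd (c ∷ cs) → runs ⌊ c /2⌋ (concatMap block cs) ≡ c ∷ cs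
runs-blocks {c} {[]}      (odd ∷ [])   = cong [_] (odd⇒2⌊c/2⌋+1≡c odd)
runs-blocks {c} {c′ ∷ cs} (odd ∷ odds) = cong₂ _∷_ (odd⇒2⌊c/2⌋+1≡c odd)
  (trans (runs-dominoes-++ 0 ⌊ c′ /2⌋ _) (runs-blocks odds))

compositionOf-tilingOf : ∀ {c cs} → All Odd (c ∷ cs) → compositionOf (tilingOf (c ∷ cs)) ≡ c ∷ cs
compositionOf-tilingOf {c} odds = trans (runs-dominoes-++ 0 ⌊ c /2⌋ _) (runs-blocks odds)

dominoes-suc-++ : ∀ d w → dominoes (suc d) ++ w ≡ dominoes d ++ dominoˡ ∷ dominoʳ ∷ w
dominoes-suc-++ zero    w = refl
dominoes-suc-++ (suc d) w = cong (λ u → dominoˡ ∷ dominoʳ ∷ u) (dominoes-suc-++ d w)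

blocks-runs : ∀ d {w} → Tiling w → concatMap block (runs d w) ≡ square ∷ dominoes d ++ w
blocks-runs d [] rewrite ⌊2d+1/2⌋≡d d = refl
blocks-runs d (square∷ t) rewrite ⌊2d+1/2⌋≡d d = cong (λ u → square ∷ dominoes d ++ u) (blocks-runs 0 t)
blocks-runs d (domino∷ {w} t) = trans (blocks-runs (suc d) t) (cong (square ∷_) (dominoes-suc-++ d w))

tilingOf-compositionOf : ∀ {w} → Tiling w → tilingOf (compositionOf w) ≡ w
tilingOf-compositionOf t = cong (drop 1) (blocks-runs 0 t)

runs-odd : ∀ d {w} → Tiling w → All Odd (runs d w)
runs-odd d []          = odd-2d+1 d ∷ []
runs-odd d (square∷ t) = odd-2d+1 d ∷ runs-odd 0 t
runs-odd d (domino∷ t) = runs-odd (suc d) t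

sum-runs : ∀ d {w} → Tiling w → sum (runs d w) ≡ suc (d + d + length w)
sum-runs d [] = refl
sum-runs d (square∷ t) rewrite sum-runs 0 t = refl
sum-runs d (domino∷ {w} t) rewrite sum-runs (suc d) t | +-suc d d =
  sym (cong suc (trans (+-suc (d + d) (suc (length w))) (cong suc (+-suc (d + d) (length w)))))

length-runs : ∀ d {w} → Tiling w → length (runs d w) ≡ suc (#squares w)
length-runs d []          = refl
length-runs d (square∷ t) = cong suc (length-runs 0 t)
length-runs d (domino∷ t) = length-runs (suc d) t

-- Positions beyond the end read as squares, so `w at i ≢ square` forces `i < length w`.
infixl 5 _at_
_at_ : List Mark → ℕ → Mark
[]      at _     = square
(m ∷ w) at zero  = m
(m ∷ w) at suc i = w at i

at-length : ∀ w {i} → w at i ≢ square → i < length w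
at-length []      {i}     m≢□ = ⊥-elim (m≢□ refl)
at-length (m ∷ w) {zero}  m≢□ = s≤s z≤n
at-length (m ∷ w) {suc i} m≢□ = s≤s (at-length w m≢□)

at-++ˡ : ∀ u {w i} → i < length u → (u ++ w) at i ≡ u at i
at-++ˡ (m ∷ u) {i = zero}  _         = refl
at-++ˡ (m ∷ u) {i = suc i} (s≤s i<) = at-++ˡ u i<

at-++ʳ : ∀ u {w} j → (u ++ w) at (length u + j) ≡ w at j
at-++ʳ []      j = refl
at-++ʳ (m ∷ u) j = at-++ʳ u j

DominoHalves : List Mark → Set
DominoHalves w = ∀ i → w at i ≡ dominoˡ ⇔ w at suc i ≡ dominoʳ

tiling-head : ∀ {w} → Tiling w → w at 0 ≢ dominoʳ
tiling-head []          ()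
tiling-head (square∷ _) ()
tiling-head (domino∷ _) ()

tiling-halves : ∀ {w} → Tiling w → DominoHalves w
tiling-halves []          i = mk⇔ (λ ()) (λ ())
tiling-halves (square∷ t) zero    = mk⇔ (λ ()) (⊥-elim ∘ tiling-head t)
tiling-halves (square∷ t) (suc i) = tiling-halves t i
tiling-halves (domino∷ t) zero          = mk⇔ (λ _ → refl) (λ _ → refl)
tiling-halves (domino∷ t) (suc zero)    = mk⇔ (λ ()) (⊥-elim ∘ tiling-head t)
tiling-halves (domino∷ t) (suc (suc i)) = tiling-halves t i

halves⇒tiling : ∀ w → w at 0 ≢ dominoʳ → DominoHalves w → Tiling w
halves⇒tiling []                      _    _      = []
halves⇒tiling (square ∷ w)            _    halves =
  square∷ (halves⇒tiling w (λ r → case Equivalence.from (halves 0) r of λ ()) (halves ∘ suc))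
halves⇒tiling (dominoˡ ∷ dominoʳ ∷ w) _    halves =
  domino∷ (halves⇒tiling w (λ r → case Equivalence.from (halves 1) r of λ ()) (halves ∘ suc ∘ suc))
halves⇒tiling (dominoˡ ∷ [])          _    halves = case Equivalence.to (halves 0) refl of λ ()
halves⇒tiling (dominoˡ ∷ dominoˡ ∷ w) _    halves = case Equivalence.to (halves 0) refl of λ ()
halves⇒tiling (dominoˡ ∷ square ∷ w)  _    halves = case Equivalence.to (halves 0) refl of λ ()
halves⇒tiling (dominoʳ ∷ w)           head _      = ⊥-elim (head refl)

tiling-++ : ∀ {u w} → Tiling u → Tiling w → Tiling (u ++ w)
tiling-++ []          tw = tw
tiling-++ (square∷ t) tw = square∷ (tiling-++ t tw)
tiling-++ (domino∷ t) tw = domino∷ (tiling-++ t tw)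

tiling-++⁻ : ∀ u {w} → Tiling (u ++ w) → w at 0 ≢ dominoʳ → Tiling u × Tiling w
tiling-++⁻ []                      t           head = [] , t
tiling-++⁻ (square ∷ u)            (square∷ t) head = let (tu , tw) = tiling-++⁻ u t head in square∷ tu , tw
tiling-++⁻ (dominoˡ ∷ dominoʳ ∷ u) (domino∷ t) head = let (tu , tw) = tiling-++⁻ u t head in domino∷ tu , tw
tiling-++⁻ (dominoˡ ∷ []) {dominoʳ ∷ w} _   head = ⊥-elim (head refl)

squares : List Mark → List ℕ
squares []            = []
squares (square ∷ w)  = 0 ∷ map suc (squares w)
squares (dominoˡ ∷ w) = map suc (squares w)
squares (dominoʳ ∷ w) = map suc (squares w)

length-squares : ∀ w → length (squares w) ≡ #squares w
length-squares []            = refl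
length-squares (square ∷ w)  = cong suc (trans (length-map suc (squares w)) (length-squares w))
length-squares (dominoˡ ∷ w) = trans (length-map suc (squares w)) (length-squares w)
length-squares (dominoʳ ∷ w) = trans (length-map suc (squares w)) (length-squares w)

∈-map-suc⁻ : ∀ {i xs} → suc i ∈ map suc xs → i ∈ xs
∈-map-suc⁻ si∈ with ∈-map⁻ suc si∈
... | _ , i∈ , refl = i∈

0∉map-suc : ∀ {xs} → 0 ∈ map suc xs → ⊥
0∉map-suc 0∈ with ∈-map⁻ suc 0∈
... | _ , _ , ()

∈-squares⁻ : ∀ w {i} → i ∈ squares w → i < length w × w at i ≡ square
∈-squares⁻ (square ∷ w)  {zero}  _            = s≤s z≤n , refl
∈-squares⁻ (square ∷ w)  {suc i} (there si∈) = Product.map₁ s≤s (∈-squares⁻ w (∈-map-suc⁻ si∈))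
∈-squares⁻ (dominoˡ ∷ w) {zero}  0∈          = ⊥-elim (0∉map-suc 0∈)
∈-squares⁻ (dominoˡ ∷ w) {suc i} si∈         = Product.map₁ s≤s (∈-squares⁻ w (∈-map-suc⁻ si∈))
∈-squares⁻ (dominoʳ ∷ w) {zero}  0∈          = ⊥-elim (0∉map-suc 0∈)
∈-squares⁻ (dominoʳ ∷ w) {suc i} si∈         = Product.map₁ s≤s (∈-squares⁻ w (∈-map-suc⁻ si∈))

∈-squares⁺ : ∀ w {i} → i < length w → w at i ≡ square → i ∈ squares w
∈-squares⁺ (square ∷ w)  {zero}  _        _ = here refl
∈-squares⁺ (square ∷ w)  {suc i} (s≤s i<) □ = there (∈-map⁺ suc (∈-squares⁺ w i< □))
∈-squares⁺ (dominoˡ ∷ w) {suc i} (s≤s i<) □ = ∈-map⁺ suc (∈-squares⁺ w i< □)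
∈-squares⁺ (dominoʳ ∷ w) {suc i} (s≤s i<) □ = ∈-map⁺ suc (∈-squares⁺ w i< □)

map-suc-increasing : ∀ {xs} → AllPairs _<_ xs → AllPairs _<_ (map suc xs)
map-suc-increasing = AllPairs.map⁺ ∘ AllPairs.map s≤s

squares-increasing : ∀ w → AllPairs _<_ (squares w)
squares-increasing []            = []
squares-increasing (square ∷ w)  =
  All.map⁺ (All.universal (λ _ → s≤s z≤n) (squares w)) ∷ map-suc-increasing (squares-increasing w)
squares-increasing (dominoˡ ∷ w) = map-suc-increasing (squares-increasing w)
squares-increasing (dominoʳ ∷ w) = map-suc-increasing (squares-increasing w)

squares-unique : ∀ w → Unique (squares w)
squares-unique w = AllPairs.map <⇒≢ (squares-increasing w)

at-applyUpTo : ∀ (f : ℕ → Mark) {m i} → i < m → applyUpTo f m at i ≡ f i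
at-applyUpTo f {suc m} {zero}  _        = refl
at-applyUpTo f {suc m} {suc i} (s≤s i<) = at-applyUpTo (f ∘ suc) i<

at-beyond : ∀ w {i} → length w ≤ i → w at i ≡ square
at-beyond []      _        = refl
at-beyond (m ∷ w) (s≤s l≤) = at-beyond w l≤

applyUpTo-≡ : ∀ (f : ℕ → Mark) {m} w → length w ≡ m → (∀ {i} → i < m → f i ≡ w at i) →
              applyUpTo f m ≡ w
applyUpTo-≡ f []      refl _  = refl
applyUpTo-≡ f (x ∷ w) refl f≡ = cong₂ _∷_ (f≡ (s≤s z≤n)) (applyUpTo-≡ (f ∘ suc) w refl (f≡ ∘ s≤s))

-- The entry of ys at the position of z in xs (0 if z ∉ xs).
match : List ℕ → List ℕ → ℕ → ℕ
match (x ∷ xs) (y ∷ ys) z with z ≟ x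
... | yes _ = y
... | no  _ = match xs ys z
match _ _ _ = 0

match-head : ∀ x xs y ys → match (x ∷ xs) (y ∷ ys) x ≡ y
match-head x xs y ys with x ≟ x
... | yes _   = refl
... | no x≢x = ⊥-elim (x≢x refl)

match-tail : ∀ {x xs y ys z} → z ≢ x → match (x ∷ xs) (y ∷ ys) z ≡ match xs ys z
match-tail {x} {z = z} z≢x with z ≟ x
... | yes z≡x = ⊥-elim (z≢x z≡x)
... | no  _   = refl

match-∈ : ∀ {xs ys z} → length xs ≡ length ys → z ∈ xs → match xs ys z ∈ ys
match-∈ {x ∷ xs} {y ∷ ys} {z} eq z∈ with z ≟ x | z∈
... | yes _   | _         = here refl
... | no  z≢x | here z≡x  = ⊥-elim (z≢x z≡x)
... | no  _   | there z∈′ = there (match-∈ (suc-injective eq) z∈′)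

match-inverse : ∀ {xs ys z} → Unique ys → length xs ≡ length ys → z ∈ xs →
                match ys xs (match xs ys z) ≡ z
match-inverse {x ∷ xs} {y ∷ ys} {z} (y∉ys ∷ ys!) eq z∈ with z ≟ x | z∈
... | yes refl | _         = match-head y ys x xs
... | no  z≢x  | here z≡x  = ⊥-elim (z≢x z≡x)
... | no  _    | there z∈′ =
  trans (match-tail (λ m≡y → All.lookup y∉ys m∈ (sym m≡y))) (match-inverse ys! (suc-injective eq) z∈′)
  where m∈ = match-∈ (suc-injective eq) z∈′

match-monotone : ∀ {xs ys z z′} → AllPairs _<_ xs → AllPairs _<_ ys → length xs ≡ length ys →
                 z ∈ xs → z′ ∈ xs → z < z′ → match xs ys z < match xs ys z′
match-monotone {x ∷ xs} {y ∷ ys} {z} {z′} (x< ∷ xs<) (y< ∷ ys<) eq z∈ z′∈ z<z′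
  with z ≟ x | z′ ≟ x | z∈ | z′∈
... | _       | yes refl | here refl | _          = ⊥-elim (<-irrefl refl z<z′)
... | _       | yes refl | there z∈′ | _          = ⊥-elim (<-asym z<z′ (All.lookup x< z∈′))
... | yes _   | no  z′≢x | _         | here z′≡x  = ⊥-elim (z′≢x z′≡x)
... | yes _   | no  _    | _         | there z′∈′ = All.lookup y< (match-∈ (suc-injective eq) z′∈′)
... | no  z≢x | no  _    | here z≡x  | _          = ⊥-elim (z≢x z≡x)
... | no  _   | no  z′≢x | there _   | here z′≡x  = ⊥-elim (z′≢x z′≡x)
... | no  _   | no  _    | there z∈′ | there z′∈′ =
  match-monotone xs< ys< (suc-injective eq) z∈′ z′∈′ z<z′

match-map : ∀ (f : ℕ → ℕ) {xs z} → z ∈ xs → match xs (map f xs) z ≡ f z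
match-map f {x ∷ xs} {z} z∈ with z ≟ x | z∈
... | yes refl | _         = refl
... | no  z≢x  | here z≡x  = ⊥-elim (z≢x z≡x)
... | no  _    | there z∈′ = match-map f z∈′

increasing-≡ : ∀ {xs ys} → AllPairs _<_ xs → AllPairs _<_ ys →
               (∀ {z} → z ∈ xs → z ∈ ys) → (∀ {z} → z ∈ ys → z ∈ xs) → xs ≡ ys
increasing-≡ {[]}     {[]}     _ _ _ _ = refl
increasing-≡ {[]}     {y ∷ ys} _ _ _ ys⊆ with ys⊆ (here refl)
... | ()
increasing-≡ {x ∷ xs} {[]}     _ _ xs⊆ _ with xs⊆ (here refl)
... | ()
increasing-≡ {x ∷ xs} {y ∷ ys} (x< ∷ xs<) (y< ∷ ys<) xs⊆ ys⊆ with head≡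
  where
  head≡ : x ≡ y
  head≡ with xs⊆ (here refl) | ys⊆ (here refl)
  ... | here x≡y | _         = x≡y
  ... | there _  | here y≡x  = sym y≡x
  ... | there x∈ | there y∈  = ⊥-elim (<-asym (All.lookup y< x∈) (All.lookup x< y∈))
... | refl = cong (x ∷_) (increasing-≡ xs< ys<
  (λ z∈ → drop-head (All.lookup x< z∈) (xs⊆ (there z∈)))
  (λ z∈ → drop-head (All.lookup y< z∈) (ys⊆ (there z∈))))
  where
  drop-head : ∀ {z zs} → x < z → z ∈ x ∷ zs → z ∈ zs
  drop-head x<z (here refl) = ⊥-elim (<-irrefl refl x<z)
  drop-head _   (there z∈) = z∈

map-increasing : ∀ (f : ℕ → ℕ) {xs} → AllPairs _<_ xs →
                 (∀ {z z′} → z ∈ xs → z′ ∈ xs → z < z′ → f z < f z′) → AllPairs _<_ (map f xs)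
map-increasing f {[]}     []          mono = []
map-increasing f {x ∷ xs} (x< ∷ xs<) mono =
  All.map⁺ (All.tabulate (λ z∈ → mono (here refl) (there z∈) (All.lookup x< z∈)))
  ∷ map-increasing f xs< (λ z∈ z′∈ → mono (there z∈) (there z′∈))

-- Pairings as partner functions

-- Phrased with ≮ so that it is reflected by sameLine of Defs.
SameLine : ℕ → ℕ → ℕ → Set
SameLine k i p = (i < k × p < k) ⊎ (i ≮ k × p ≮ k)

Between : ℕ → ℕ → ℕ → Set
Between i z p = (i < z × z < p) ⊎ (p < z × z < i)

-- isValidPairing read on the partner function: having no fixed points follows from
-- `adjacent`, which also says that no marked point lies on a segment along a line, and
-- `monotone` says that the segments between the lines do not cross.
record IsNonCrossing (k n : ℕ) (π : ℕ → ℕ) : Set where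
  field
    bounded    : ∀ {i} → i < k + n → π i < k + n
    involutive : ∀ {i} → i < k + n → π (π i) ≡ i
    adjacent   : ∀ {i} → i < k + n → SameLine k i (π i) → π i ≡ suc i ⊎ suc (π i) ≡ i
    monotone   : ∀ {i j} → i < j → j < k → k ≤ π i → k ≤ π j → π i < π j

partnerOf : ∀ {N} → Vec (Fin N) N → ℕ → ℕ
partnerOf {N} v i with i <? N
... | yes i<N = toℕ (lookup v (fromℕ< i<N))
... | no  _   = i

partnerOf-toℕ : ∀ {N} (v : Vec (Fin N) N) x → partnerOf v (toℕ x) ≡ toℕ (lookup v x)
partnerOf-toℕ {N} v x with toℕ x <? N
... | yes x<N = cong (toℕ ∘ lookup v) (fromℕ<-toℕ x x<N)
... | no  x≮N = contradiction (toℕ<n x) x≮N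

partnerOf-< : ∀ {N} (v : Vec (Fin N) N) {i} → i < N → partnerOf v i < N
partnerOf-< {N} v {i} i<N with i <? N
... | yes _   = toℕ<n _
... | no  i≮N = contradiction i<N i≮N

toFinOr : ∀ {N} → Fin N → ℕ → Fin N
toFinOr {N} x p with p <? N
... | yes p<N = fromℕ< p<N
... | no  _   = x

toℕ-toFinOr : ∀ {N} (x : Fin N) {p} → p < N → toℕ (toFinOr x p) ≡ p
toℕ-toFinOr {N} x {p} p<N with p <? N
... | yes _   = toℕ-fromℕ< _
... | no  p≮N = contradiction p<N p≮N

fromPartner : ∀ {N} → (ℕ → ℕ) → Vec (Fin N) N
fromPartner π = tabulate (λ x → toFinOr x (π (toℕ x)))

partnerOf-fromPartner : ∀ {N} (π : ℕ → ℕ) {i} → i < N → π i < N → partnerOf {N} (fromPartner π) i ≡ π i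
partnerOf-fromPartner {N} π {i} i<N πi<N =
  begin
    partnerOf v i               ≡⟨ cong (partnerOf v) (sym x≡i) ⟩
    partnerOf v (toℕ x)         ≡⟨ partnerOf-toℕ v x ⟩
    toℕ (lookup v x)            ≡⟨ cong toℕ (lookup∘tabulate _ x) ⟩
    toℕ (toFinOr x (π (toℕ x))) ≡⟨ toℕ-toFinOr x (subst (λ j → π j < N) (sym x≡i) πi<N) ⟩
    π (toℕ x)                   ≡⟨ cong π x≡i ⟩
    π i                         ∎
  where
  open ≡-Reasoning
  v = fromPartner {N} π
  x = fromℕ< i<N
  x≡i = toℕ-fromℕ< i<N

fromPartner-partnerOf : ∀ {N} (v : Vec (Fin N) N) → fromPartner (partnerOf v) ≡ v
fromPartner-partnerOf v = trans (tabulate-cong entry) (tabulate∘lookup v)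
  where
  entry : ∀ x → toFinOr x (partnerOf v (toℕ x)) ≡ lookup v x
  entry x = toℕ-injective (trans (toℕ-toFinOr x (partnerOf-< v (toℕ<n x))) (partnerOf-toℕ v x))

reflects⇒T⇔ : ∀ {A : Set} {b} → Reflects A b → T b ⇔ A
reflects⇒T⇔ (ofʸ a)  = mk⇔ (λ _ → a) (λ _ → _)
reflects⇒T⇔ (ofⁿ ¬a) = mk⇔ (λ ()) ¬a

≡ᵇ-reflects-≡ : ∀ m n → Reflects (m ≡ n) (m ≡ᵇ n)
≡ᵇ-reflects-≡ m n = fromEquivalence (≡ᵇ⇒≡ m n) (≡⇒≡ᵇ m n)

∀Fin⇔∀< : ∀ {N} {P : ℕ → Set} → (∀ (x : Fin N) → P (toℕ x)) ⇔ (∀ i → i < N → P i)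
∀Fin⇔∀< {N} {P} = mk⇔ to from
  where
  to : (∀ (x : Fin N) → P (toℕ x)) → ∀ i → i < N → P i
  to h i i<N = subst P (toℕ-fromℕ< i<N) (h (fromℕ< i<N))
  from : (∀ i → i < N → P i) → ∀ (x : Fin N) → P (toℕ x)
  from h x = h (toℕ x) (toℕ<n x)

T-forallPt : ∀ k n {P : ℕ → Set} (p : Fin (k + n) → Bool) → (∀ x → T (p x) ⇔ P (toℕ x)) →
             T (forallPt k n p) ⇔ (∀ i → i < k + n → P i)
T-forallPt k n p T-p = mk⇔
  (λ t → Equivalence.to ∀Fin⇔∀< λ x → Equivalence.to (T-p x) (All.lookup (Equivalence.to T-all t) (∈-allFin x)))
  (λ h → Equivalence.from T-all (All.tabulate λ {x} _ → Equivalence.from (T-p x) (Equivalence.from ∀Fin⇔∀< h x)))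
  where T-all = T-allᵇ p (allFin (k + n))

sameLine? : ∀ k i p → Dec (SameLine k i p)
sameLine? k i p = (i <? k ×-dec p <? k) ⊎-dec (¬? (i <? k) ×-dec ¬? (p <? k))

SameLine-sym : ∀ {k i p} → SameLine k i p → SameLine k p i
SameLine-sym (inj₁ (i<k , p<k)) = inj₁ (p<k , i<k)
SameLine-sym (inj₂ (i≮k , p≮k)) = inj₂ (p≮k , i≮k)

SameLine-refl : ∀ k i → SameLine k i i
SameLine-refl k i with i <? k
... | yes i<k = inj₁ (i<k , i<k)
... | no  i≮k = inj₂ (i≮k , i≮k)

adjacent⇒nothing-between : ∀ {i z p} → p ≡ suc i ⊎ suc p ≡ i → ¬ Between i z p
adjacent⇒nothing-between (inj₁ refl) (inj₁ (i<z , z<p)) = <⇒≱ i<z (m<1+n⇒m≤n z<p)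
adjacent⇒nothing-between (inj₁ refl) (inj₂ (p<z , z<i)) = <-asym (<-trans (n<1+n _) p<z) z<i
adjacent⇒nothing-between (inj₂ refl) (inj₁ (i<z , z<p)) = <-asym (<-trans (n<1+n _) i<z) z<p
adjacent⇒nothing-between (inj₂ refl) (inj₂ (p<z , z<i)) = <⇒≱ p<z (m<1+n⇒m≤n z<i)

adjacent-or-between : ∀ {N i p} → i < N → p < N → p ≢ i →
                      (p ≡ suc i ⊎ suc p ≡ i) ⊎ ∃ λ z → z < N × Between i z p
adjacent-or-between {i = i} {p} i<N p<N p≢i with <-cmp p i
... | tri≈ _ p≡i _ = contradiction p≡i p≢i
... | tri< p<i _ _ with m≤n⇒m<n∨m≡n p<i
...   | inj₂ sp≡i = inj₁ (inj₂ sp≡i)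
...   | inj₁ sp<i = inj₂ (suc p , <-trans sp<i i<N , inj₂ (n<1+n p , sp<i))
adjacent-or-between {i = i} {p} i<N p<N p≢i | tri> _ _ i<p with m≤n⇒m<n∨m≡n i<p
...   | inj₂ si≡p = inj₁ (inj₁ (sym si≡p))
...   | inj₁ si<p = inj₂ (suc i , <-trans si<p p<N , inj₁ (n<1+n i , si<p))

module _ {k n : ℕ} (v : Vec (Fin (k + n)) (k + n)) where

  private
    π = partnerOf v

  Crosses : ℕ → Set
  Crosses i = i < k × π i ≮ k

  pairs-reflects : ∀ x → Reflects (π (toℕ x) ≢ toℕ x × π (π (toℕ x)) ≡ toℕ x)
    (not (eqᵇ k n (lookup v x) x) ∧ eqᵇ k n (lookup v (lookup v x)) x)
  pairs-reflects x rewrite partnerOf-toℕ v x | partnerOf-toℕ v (lookup v x) =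
    ¬-reflects (≡ᵇ-reflects-≡ _ _) ×-reflects ≡ᵇ-reflects-≡ _ _

  sameLine-reflects : ∀ x y → Reflects (SameLine k (toℕ x) (toℕ y)) (sameLine k n x y)
  sameLine-reflects x y = (<ᵇ-reflects-< _ _ ×-reflects <ᵇ-reflects-< _ _)
    ⊎-reflects (¬-reflects (<ᵇ-reflects-< _ _) ×-reflects ¬-reflects (<ᵇ-reflects-< _ _))

  between-reflects : ∀ x z y → Reflects (Between (toℕ x) (toℕ z) (toℕ y)) (between k n x z y)
  between-reflects x z y = (<ᵇ-reflects-< _ _ ×-reflects <ᵇ-reflects-< _ _)
    ⊎-reflects (<ᵇ-reflects-< _ _ ×-reflects <ᵇ-reflects-< _ _)

  noPoint-reflects : ∀ x z →
    Reflects (¬ (SameLine k (toℕ x) (π (toℕ x)) × Between (toℕ x) (toℕ z) (π (toℕ x))))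
    (not (sameLine k n x (lookup v x) ∧ between k n x z (lookup v x)))
  noPoint-reflects x z rewrite partnerOf-toℕ v x =
    ¬-reflects (sameLine-reflects x (lookup v x) ×-reflects between-reflects x z (lookup v x))

  crosses-reflects : ∀ x → Reflects (Crosses (toℕ x)) (isCross k n v x)
  crosses-reflects x rewrite partnerOf-toℕ v x = <ᵇ-reflects-< _ _ ×-reflects ¬-reflects (<ᵇ-reflects-< _ _)

  noCrossing-reflects : ∀ x y →
    Reflects (¬ (Crosses (toℕ x) × Crosses (toℕ y) × toℕ x < toℕ y × π (toℕ x) ≮ π (toℕ y)))
    (not (isCross k n v x ∧ isCross k n v y ∧ (toℕ x <ᵇ toℕ y) ∧ not (toℕ (lookup v x) <ᵇ toℕ (lookup v y))))
  noCrossing-reflects x y =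
    ¬-reflects (crosses-reflects x ×-reflects crosses-reflects y ×-reflects
                <ᵇ-reflects-< _ _ ×-reflects ¬-reflects partners<)
    where
    partners< : Reflects (π (toℕ x) < π (toℕ y)) (toℕ (lookup v x) <ᵇ toℕ (lookup v y))
    partners< rewrite partnerOf-toℕ v x | partnerOf-toℕ v y = <ᵇ-reflects-< _ _

  T-isPairing : T (isPairing k n v) ⇔ (∀ i → i < k + n → π i ≢ i × π (π i) ≡ i)
  T-isPairing = T-forallPt k n _ (reflects⇒T⇔ ∘ pairs-reflects)

  T-noPointOnSegment : T (noPointOnSegment k n v) ⇔
    (∀ i → i < k + n → ∀ z → z < k + n → ¬ (SameLine k i (π i) × Between i z (π i)))
  T-noPointOnSegment = T-forallPt k n _ (λ x → T-forallPt k n _ (reflects⇒T⇔ ∘ noPoint-reflects x))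

  T-noCrossing : T (noCrossing k n v) ⇔
    (∀ i → i < k + n → ∀ j → j < k + n → ¬ (Crosses i × Crosses j × i < j × π i ≮ π j))
  T-noCrossing = T-forallPt k n _ (λ x → T-forallPt k n _ (reflects⇒T⇔ ∘ noCrossing-reflects x))

  T-isValidPairing : T (isValidPairing k n v) ⇔ IsNonCrossing k n π
  T-isValidPairing = mk⇔ to from
    where
    to : T (isValidPairing k n v) → IsNonCrossing k n π
    to valid = record
      { bounded    = partnerOf-< v
      ; involutive = λ {i} i< → proj₂ (pairs i i<)
      ; adjacent   = adjacent
      ; monotone   = monotone
      }
      where
      conditions          = Equivalence.to T-∧ valid
      pairs               = Equivalence.to T-isPairing (proj₁ conditions)
      rest                = Equivalence.to T-∧ (proj₂ conditions)
      nothing-on-segments = Equivalence.to T-noPointOnSegment (proj₁ rest)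
      crossings-ordered   = Equivalence.to T-noCrossing (proj₂ rest)

      adjacent : ∀ {i} → i < k + n → SameLine k i (π i) → π i ≡ suc i ⊎ suc (π i) ≡ i
      adjacent {i} i< same with adjacent-or-between i< (partnerOf-< v i<) (proj₁ (pairs i i<))
      ... | inj₁ adj              = adj
      ... | inj₂ (z , z< , btw) = contradiction (same , btw) (nothing-on-segments i i< z z<)

      monotone : ∀ {i j} → i < j → j < k → k ≤ π i → k ≤ π j → π i < π j
      monotone {i} {j} i<j j<k k≤πi k≤πj = decidable-stable (π i <? π j) λ πi≮πj →
        crossings-ordered i (<-trans i<j j<N) j j<N
          ((<-trans i<j j<k , ≤⇒≯ k≤πi) , (j<k , ≤⇒≯ k≤πj) , i<j , πi≮πj)
        where j<N = <-≤-trans j<k (m≤m+n k n)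

    from : IsNonCrossing k n π → T (isValidPairing k n v)
    from nc = Equivalence.from T-∧ (Equivalence.from T-isPairing pairs ,
                Equivalence.from T-∧ (Equivalence.from T-noPointOnSegment nothing-on-segments ,
                                      Equivalence.from T-noCrossing crossings-ordered))
      where
      open IsNonCrossing nc

      pairs : ∀ i → i < k + n → π i ≢ i × π (π i) ≡ i
      pairs i i< = no-fixed-point , involutive i<
        where
        no-fixed-point : π i ≢ i
        no-fixed-point πi≡i with adjacent i< (subst (SameLine k i) (sym πi≡i) (SameLine-refl k i))
        ... | inj₁ πi≡si = <-irrefl (trans (sym πi≡i) πi≡si) (n<1+n i)
        ... | inj₂ sπi≡i = <-irrefl (sym (trans (cong suc (sym πi≡i)) sπi≡i)) (n<1+n i)

      nothing-on-segments : ∀ i → i < k + n → ∀ z → z < k + n → ¬ (SameLine k i (π i) × Between i z (π i))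
      nothing-on-segments i i< z _ (same , btw) = adjacent⇒nothing-between (adjacent i< same) btw

      crossings-ordered : ∀ i → i < k + n → ∀ j → j < k + n → ¬ (Crosses i × Crosses j × i < j × π i ≮ π j)
      crossings-ordered i _ j _ ((_ , πi≮k) , (j<k , πj≮k) , i<j , πi≮πj) =
        πi≮πj (monotone i<j j<k (≮⇒≥ πi≮k) (≮⇒≥ πj≮k))

fromPartner-cong : ∀ {N} {π σ : ℕ → ℕ} → (∀ {i} → i < N → π i ≡ σ i) →
                   fromPartner {N} π ≡ fromPartner σ
fromPartner-cong π≡σ = tabulate-cong (λ x → cong (toFinOr x) (π≡σ (toℕ<n x)))

IsNonCrossing-cong : ∀ {k n π σ} → (∀ {i} → i < k + n → σ i ≡ π i) →
                     IsNonCrossing k n π → IsNonCrossing k n σ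
IsNonCrossing-cong {k} {n} {π} {σ} σ≡π nc = record
  { bounded    = bounded′
  ; involutive = λ i<N → trans (σ≡π (bounded′ i<N)) (trans (cong π (σ≡π i<N)) (involutive i<N))
  ; adjacent   = adjacent′
  ; monotone   = monotone′
  }
  where
  open IsNonCrossing nc

  bounded′ : ∀ {i} → i < k + n → σ i < k + n
  bounded′ i<N rewrite σ≡π i<N = bounded i<N

  adjacent′ : ∀ {i} → i < k + n → SameLine k i (σ i) → σ i ≡ suc i ⊎ suc (σ i) ≡ i
  adjacent′ i<N rewrite σ≡π i<N = adjacent i<N

  monotone′ : ∀ {i j} → i < j → j < k → k ≤ σ i → k ≤ σ j → σ i < σ j
  monotone′ i<j j<k rewrite σ≡π (<-≤-trans (<-trans i<j j<k) (m≤m+n k n)) | σ≡π (<-≤-trans j<k (m≤m+n k n)) =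
    monotone i<j j<k

data Position (k : ℕ) : ℕ → Set where
  first  : ∀ {i} → i < k → Position k i
  second : ∀ j → Position k (k + j)

position : ∀ k i → Position k i
position k i with i <? k
... | yes i<k = first i<k
... | no  i≮k = subst (Position k) (m+[n∸m]≡n (≮⇒≥ i≮k)) (second (i ∸ k))

markOf : ℕ → ℕ → ℕ → Mark
markOf k i p with sameLine? k i p | p ≟ suc i
... | yes _ | yes _ = dominoˡ
... | yes _ | no  _ = dominoʳ
... | no  _ | _     = square

data MarkView (k i p : ℕ) : Mark → Set where
  opens   : SameLine k i p → p ≡ suc i → MarkView k i p dominoˡ
  closes  : SameLine k i p → p ≢ suc i → MarkView k i p dominoʳ
  crosses : ¬ SameLine k i p → MarkView k i p square

markView : ∀ k i p → MarkView k i p (markOf k i p)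
markView k i p with sameLine? k i p | p ≟ suc i
... | yes same | yes p≡si = opens same p≡si
... | yes same | no  p≢si = closes same p≢si
... | no  ¬same | _       = crosses ¬same

markOf-opens : ∀ {k i} → SameLine k i (suc i) → markOf k i (suc i) ≡ dominoˡ
markOf-opens {k} {i} same with markOf k i (suc i) | markView k i (suc i)
... | _ | opens _ _      = refl
... | _ | closes _ si≢si = contradiction refl si≢si
... | _ | crosses ¬same  = contradiction same ¬same

markOf-closes : ∀ {k j} → SameLine k (suc j) j → markOf k (suc j) j ≡ dominoʳ
markOf-closes {k} {j} same with markOf k (suc j) j | markView k (suc j) j
... | _ | opens _ j≡ssj = contradiction j≡ssj (<⇒≢ (m<n⇒m<1+n (n<1+n j)))
... | _ | closes _ _     = refl
... | _ | crosses ¬same  = contradiction same ¬same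

markOf-crosses : ∀ {k i p} → ¬ SameLine k i p → markOf k i p ≡ square
markOf-crosses {k} {i} {p} ¬same with markOf k i p | markView k i p
... | _ | opens same _  = contradiction same ¬same
... | _ | closes same _ = contradiction same ¬same
... | _ | crosses _     = refl

-- From a pair of tilings to a pairing

module Encoding (k : ℕ) (w₁ w₂ : List Mark) where

  -- The r-th square of one line is joined to the r-th square of the other.
  crossPartner : ℕ → ℕ
  crossPartner i with i <? k
  ... | yes _ = k + match (squares w₁) (squares w₂) i
  ... | no  _ = match (squares w₂) (squares w₁) (i ∸ k)

  partnerBy : Mark → ℕ → ℕ
  partnerBy dominoˡ i = suc i
  partnerBy dominoʳ i = pred i
  partnerBy square  i = crossPartner i

  partner : ℕ → ℕ
  partner i = partnerBy ((w₁ ++ w₂) at i) i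

  crossPartner-first : ∀ {i} → i < k → crossPartner i ≡ k + match (squares w₁) (squares w₂) i
  crossPartner-first {i} i<k with i <? k
  ... | yes _   = refl
  ... | no  i≮k = contradiction i<k i≮k

  crossPartner-second : ∀ j → crossPartner (k + j) ≡ match (squares w₂) (squares w₁) j
  crossPartner-second j with k + j <? k
  ... | yes k+j<k = contradiction k+j<k (m+n≮m k j)
  ... | no  _     = cong (match (squares w₂) (squares w₁)) (m+n∸m≡n k j)

  module Properties (n : ℕ) (t₁ : Tiling w₁) (t₂ : Tiling w₂)
                    (length₁ : length w₁ ≡ k) (length₂ : length w₂ ≡ n)
                    (#squares≡ : #squares w₁ ≡ #squares w₂) where

    private
      W  = w₁ ++ w₂
      P₁ = squares w₁
      P₂ = squares w₂

    length-P : length P₁ ≡ length P₂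
    length-P = trans (length-squares w₁) (trans #squares≡ (sym (length-squares w₂)))

    W-first : ∀ {i} → i < k → W at i ≡ w₁ at i
    W-first i<k = at-++ˡ w₁ (subst (_ <_) (sym length₁) i<k)

    W-second : ∀ j → W at (k + j) ≡ w₂ at j
    W-second j = subst (λ l → W at (l + j) ≡ w₂ at j) length₁ (at-++ʳ w₁ j)

    tiling-W : Tiling W
    tiling-W = tiling-++ t₁ t₂

    length-W : length W ≡ k + n
    length-W = trans (length-++ w₁) (cong₂ _+_ length₁ length₂)

    next-dominoʳ : ∀ {i} → W at i ≡ dominoˡ → W at suc i ≡ dominoʳ
    next-dominoʳ = Equivalence.to (tiling-halves tiling-W _)

    prev-dominoˡ : ∀ {i} → W at i ≡ dominoʳ → ∃ λ j → i ≡ suc j × W at j ≡ dominoˡ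
    prev-dominoˡ {zero}  r = contradiction r (tiling-head tiling-W)
    prev-dominoˡ {suc j} r = j , refl , Equivalence.from (tiling-halves tiling-W j) r

    dominoˡ-sameLine : ∀ {i} → W at i ≡ dominoˡ → SameLine k i (suc i)
    dominoˡ-sameLine {i} l with position k i
    ... | first i<k = inj₁ (i<k , subst (_ <_) length₁ (at-length w₁ (subst (_≢ square) (sym r) λ ())))
      where r = Equivalence.to (tiling-halves t₁ i) (trans (sym (W-first i<k)) l)
    ... | second j  = inj₂ (m+n≮m k j , subst (_≮ k) (+-suc k j) (m+n≮m k (suc j)))

    ∈P₁⁺ : ∀ {i} → i < k → W at i ≡ square → i ∈ P₁
    ∈P₁⁺ i<k □ = ∈-squares⁺ w₁ (subst (_ <_) (sym length₁) i<k) (trans (sym (W-first i<k)) □)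

    ∈P₂⁺ : ∀ {j} → k + j < k + n → W at (k + j) ≡ square → j ∈ P₂
    ∈P₂⁺ k+j<N □ =
      ∈-squares⁺ w₂ (subst (_ <_) (sym length₂) (+-cancelˡ-< k _ _ k+j<N)) (trans (sym (W-second _)) □)

    ∈P₁⁻ : ∀ {i} → i ∈ P₁ → i < k × W at i ≡ square
    ∈P₁⁻ i∈ = let (i< , □) = ∈-squares⁻ w₁ i∈ ; i<k = subst (_ <_) length₁ i<
              in i<k , trans (W-first i<k) □

    ∈P₂⁻ : ∀ {j} → j ∈ P₂ → j < n × W at (k + j) ≡ square
    ∈P₂⁻ j∈ = let (j< , □) = ∈-squares⁻ w₂ j∈ in subst (_ <_) length₂ j< , trans (W-second _) □

    record CrossPartner (i : ℕ) : Set where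
      field
        other-line : ¬ SameLine k i (crossPartner i)
        in-range   : crossPartner i < k + n
        square-at  : W at crossPartner i ≡ square
        involutive : crossPartner (crossPartner i) ≡ i

    crossPartner-square : ∀ {i} → i < k + n → W at i ≡ square → CrossPartner i
    crossPartner-square {i} i<N □ with position k i
    ... | first i<k = record
      { other-line = λ { (inj₁ (_ , m<k)) → m+n≮m k _ (subst (_< k) πi≡ m<k) ; (inj₂ (i≮k , _)) → i≮k i<k }
      ; in-range   = subst (_< k + n) (sym πi≡) (+-monoʳ-< k m<n)
      ; square-at  = subst (λ p → W at p ≡ square) (sym πi≡) m□
      ; involutive = trans (cong crossPartner πi≡) (trans (crossPartner-second m)
                       (match-inverse (squares-unique w₂) length-P i∈))
      }
      where
      i∈  = ∈P₁⁺ i<k □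
      m   = match P₁ P₂ i
      πi≡ = crossPartner-first i<k
      m<n = proj₁ (∈P₂⁻ (match-∈ length-P i∈))
      m□  = proj₂ (∈P₂⁻ (match-∈ length-P i∈))
    ... | second j = record
      { other-line = λ { (inj₁ (k+j<k , _)) → m+n≮m k j k+j<k
                       ; (inj₂ (_ , m≮k))   → m≮k (subst (_< k) (sym πi≡) m<k) }
      ; in-range   = subst (_< k + n) (sym πi≡) (<-≤-trans m<k (m≤m+n k n))
      ; square-at  = subst (λ p → W at p ≡ square) (sym πi≡) m□
      ; involutive = trans (cong crossPartner πi≡) (trans (crossPartner-first m<k)
                       (cong (k +_) (match-inverse (squares-unique w₁) (sym length-P) j∈)))
      }
      where
      j∈  = ∈P₂⁺ i<N □
      m   = match P₂ P₁ j
      πi≡ = crossPartner-second j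
      m<k = proj₁ (∈P₁⁻ (match-∈ (sym length-P) j∈))
      m□  = proj₂ (∈P₁⁻ (match-∈ (sym length-P) j∈))

    first-crossing : ∀ {i} → i < k → k ≤ partner i → i ∈ P₁ × partner i ≡ k + match P₁ P₂ i
    first-crossing {i} i<k k≤πi with W at i in eq
    ... | dominoˡ = contradiction (proj₂ (sameLine-first (dominoˡ-sameLine eq))) (≤⇒≯ k≤πi)
      where
      sameLine-first : SameLine k i (suc i) → i < k × suc i < k
      sameLine-first (inj₁ both)     = both
      sameLine-first (inj₂ (i≮k , _)) = contradiction i<k i≮k
    ... | dominoʳ = contradiction (≤-<-trans pred[n]≤n i<k) (≤⇒≯ k≤πi)
    ... | square  = ∈P₁⁺ i<k eq , crossPartner-first i<k

    partner-isNonCrossing : IsNonCrossing k n partner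
    partner-isNonCrossing = record
      { bounded    = bounded
      ; involutive = involutive
      ; adjacent   = adjacent
      ; monotone   = monotone
      }
      where
      bounded : ∀ {i} → i < k + n → partner i < k + n
      bounded {i} i<N with W at i in eq
      ... | dominoˡ = subst (_ <_) length-W (at-length W (subst (_≢ square) (sym (next-dominoʳ eq)) λ ()))
      ... | dominoʳ = ≤-<-trans pred[n]≤n i<N
      ... | square  = CrossPartner.in-range (crossPartner-square i<N eq)

      involutive : ∀ {i} → i < k + n → partner (partner i) ≡ i
      involutive {i} i<N with W at i in eq
      ... | dominoˡ rewrite next-dominoʳ eq = refl
      ... | dominoʳ with prev-dominoˡ eq
      ...   | j , refl , l rewrite l = refl
      involutive {i} i<N | square
        rewrite CrossPartner.square-at (crossPartner-square i<N eq) = CrossPartner.involutive (crossPartner-square i<N eq)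

      adjacent : ∀ {i} → i < k + n → SameLine k i (partner i) → partner i ≡ suc i ⊎ suc (partner i) ≡ i
      adjacent {i} i<N same with W at i in eq
      ... | dominoˡ = inj₁ refl
      ... | dominoʳ with prev-dominoˡ eq
      ...   | j , refl , _ = inj₂ refl
      adjacent {i} i<N same | square = contradiction same (CrossPartner.other-line (crossPartner-square i<N eq))

      monotone : ∀ {i j} → i < j → j < k → k ≤ partner i → k ≤ partner j → partner i < partner j
      monotone i<j j<k k≤πi k≤πj
        with first-crossing (<-trans i<j j<k) k≤πi | first-crossing j<k k≤πj
      ... | i∈ , πi≡ | j∈ , πj≡ rewrite πi≡ | πj≡ =
        +-monoʳ-< k (match-monotone (squares-increasing w₁) (squares-increasing w₂) length-P i∈ j∈ i<j)

    markOf-partner : ∀ {i} → i < k + n → markOf k i (partner i) ≡ W at i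
    markOf-partner {i} i<N with W at i in eq
    ... | dominoˡ = markOf-opens (dominoˡ-sameLine eq)
    ... | dominoʳ with prev-dominoˡ eq
    ...   | j , refl , l = markOf-closes (SameLine-sym (dominoˡ-sameLine l))
    markOf-partner {i} i<N | square = markOf-crosses (CrossPartner.other-line (crossPartner-square i<N eq))

-- From a pairing to a pair of tilings

module Decoding (k n : ℕ) (π : ℕ → ℕ) where

  line₁ line₂ : List Mark
  line₁ = applyUpTo (λ i → markOf k i (π i)) k
  line₂ = applyUpTo (λ j → markOf k (k + j) (π (k + j))) n

  W-at : ∀ {i} → i < k + n → (line₁ ++ line₂) at i ≡ markOf k i (π i)
  W-at {i} i<N with position k i
  ... | first i<k = trans (at-++ˡ line₁ (subst (_ <_) (sym (length-applyUpTo _ k)) i<k)) (at-applyUpTo _ i<k)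
  ... | second j  =
    trans (subst (λ l → (line₁ ++ line₂) at (l + j) ≡ line₂ at j) (length-applyUpTo _ k) (at-++ʳ line₁ j))
          (at-applyUpTo _ (+-cancelˡ-< k _ _ i<N))

  module Properties (nc : IsNonCrossing k n π) where

    open IsNonCrossing nc

    private
      W  = line₁ ++ line₂
      P₁ = squares line₁
      P₂ = squares line₂

    length-W : length W ≡ k + n
    length-W = trans (length-++ line₁) (cong₂ _+_ (length-applyUpTo _ k) (length-applyUpTo _ n))

    opens⇒ : ∀ {i} → markOf k i (π i) ≡ dominoˡ → π i ≡ suc i × SameLine k i (π i)
    opens⇒ {i} eq with markOf k i (π i) | markView k i (π i)
    opens⇒ refl | _ | opens same πi≡ = πi≡ , same

    closes⇒ : ∀ {i} → i < k + n → markOf k i (π i) ≡ dominoʳ → suc (π i) ≡ i × SameLine k i (π i)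
    closes⇒ {i} i<N eq with markOf k i (π i) | markView k i (π i)
    closes⇒ {i} i<N refl | _ | closes same πi≢si with adjacent i<N same
    ... | inj₁ πi≡si = contradiction πi≡si πi≢si
    ... | inj₂ sπi≡i = sπi≡i , same

    crosses⇒ : ∀ {i} → markOf k i (π i) ≡ square → ¬ SameLine k i (π i)
    crosses⇒ {i} eq with markOf k i (π i) | markView k i (π i)
    crosses⇒ refl | _ | crosses ¬same = ¬same

    W-halves : DominoHalves W
    W-halves i with suc i <? k + n
    ... | yes si<N = mk⇔ to from
      where
      i<N = <-trans (n<1+n i) si<N

      to : W at i ≡ dominoˡ → W at suc i ≡ dominoʳ
      to l = trans (W-at si<N) (subst (λ p → markOf k (suc i) p ≡ dominoʳ) (sym πsi≡i) (markOf-closes same))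
        where
        opened = opens⇒ (trans (sym (W-at i<N)) l)
        πsi≡i  = trans (cong π (sym (proj₁ opened))) (involutive i<N)
        same   = SameLine-sym (subst (SameLine k i) (proj₁ opened) (proj₂ opened))

      from : W at suc i ≡ dominoʳ → W at i ≡ dominoˡ
      from r = trans (W-at i<N) (subst (λ p → markOf k i p ≡ dominoˡ) (sym πi≡si) (markOf-opens same))
        where
        closed = closes⇒ si<N (trans (sym (W-at si<N)) r)
        πsi≡i  = suc-injective (proj₁ closed)
        πi≡si  = trans (cong π (sym πsi≡i)) (involutive si<N)
        same   = SameLine-sym (subst (SameLine k (suc i)) πsi≡i (proj₂ closed))
    ... | no si≮N = mk⇔ to (λ r → contradiction (trans (sym r) (at-beyond W N≤si)) λ ())
      where
      N≤si = subst (_≤ suc i) (sym length-W) (≮⇒≥ si≮N)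

      to : W at i ≡ dominoˡ → W at suc i ≡ dominoʳ
      to l with i <? k + n
      ... | yes i<N = contradiction (subst (_< k + n) (proj₁ (opens⇒ (trans (sym (W-at i<N)) l))) (bounded i<N)) si≮N
      ... | no  i≮N = contradiction (trans (sym l) (at-beyond W (subst (_≤ i) (sym length-W) (≮⇒≥ i≮N)))) λ ()

    W-head : W at 0 ≢ dominoʳ
    W-head r with 0 <? k + n
    ... | yes 0<N = 1+n≢0 (proj₁ (closes⇒ 0<N (trans (sym (W-at 0<N)) r)))
    ... | no  0≮N = contradiction (trans (sym r) (at-beyond W (subst (_≤ 0) (sym length-W) (≮⇒≥ 0≮N)))) λ ()

    line₂-head : line₂ at 0 ≢ dominoʳ
    line₂-head r with 0 <? n
    ... | yes 0<n = first-does-not-close (closes⇒ k<N (trans (sym (at-applyUpTo _ 0<n)) r))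
      where
      k<N = +-monoʳ-< k 0<n
      first-does-not-close : suc (π (k + 0)) ≡ k + 0 × SameLine k (k + 0) (π (k + 0)) → ⊥
      first-does-not-close (_       , inj₁ (k+0<k , _)) = m+n≮m k 0 k+0<k
      first-does-not-close (sπ≡k+0 , inj₂ (_ , π≮k))    =
        π≮k (subst (π (k + 0) <_) (+-identityʳ k) (≤-reflexive sπ≡k+0))
    ... | no  0≮n =
      contradiction (trans (sym r) (at-beyond line₂ (subst (_≤ 0) (sym (length-applyUpTo _ n)) (≮⇒≥ 0≮n)))) λ ()

    tilings : Tiling line₁ × Tiling line₂
    tilings = tiling-++⁻ line₁ (halves⇒tiling W W-head W-halves) line₂-head

    ∈P₁⁻ : ∀ {i} → i ∈ P₁ → i < k × k ≤ π i
    ∈P₁⁻ {i} i∈ =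
      i<k , ≮⇒≥ (λ πi<k → crosses⇒ (trans (sym (at-applyUpTo _ i<k)) □) (inj₁ (i<k , πi<k)))
      where
      i<k = subst (i <_) (length-applyUpTo _ k) (proj₁ (∈-squares⁻ line₁ i∈))
      □   = proj₂ (∈-squares⁻ line₁ i∈)

    ∈P₁⁺ : ∀ {i} → i < k → k ≤ π i → i ∈ P₁
    ∈P₁⁺ {i} i<k k≤πi = ∈-squares⁺ line₁ (subst (i <_) (sym (length-applyUpTo _ k)) i<k)
      (trans (at-applyUpTo _ i<k) (markOf-crosses λ
        { (inj₁ (_ , πi<k)) → ≤⇒≯ k≤πi πi<k
        ; (inj₂ (i≮k , _)) → i≮k i<k }))

    ∈P₂⁻ : ∀ {j} → j ∈ P₂ → j < n × π (k + j) < k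
    ∈P₂⁻ {j} j∈ =
      j<n , ≰⇒> (λ k≤π → crosses⇒ (trans (sym (at-applyUpTo _ j<n)) □) (inj₂ (m+n≮m k j , ≤⇒≯ k≤π)))
      where
      j<n = subst (j <_) (length-applyUpTo _ n) (proj₁ (∈-squares⁻ line₂ j∈))
      □   = proj₂ (∈-squares⁻ line₂ j∈)

    ∈P₂⁺ : ∀ {j} → j < n → π (k + j) < k → j ∈ P₂
    ∈P₂⁺ {j} j<n π<k = ∈-squares⁺ line₂ (subst (j <_) (sym (length-applyUpTo _ n)) j<n)
      (trans (at-applyUpTo _ j<n) (markOf-crosses λ
        { (inj₁ (k+j<k , _)) → m+n≮m k j k+j<k
        ; (inj₂ (_ , π≮k)) → π≮k π<k }))

    k+[πi∸k]≡πi : ∀ {i} → i ∈ P₁ → k + (π i ∸ k) ≡ π i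
    k+[πi∸k]≡πi i∈ = m+[n∸m]≡n (proj₂ (∈P₁⁻ i∈))

    -- π maps the squares of the first line increasingly onto k + the squares of the second,
    -- hence in order.
    map-P₁ : map (λ i → π i ∸ k) P₁ ≡ P₂
    map-P₁ = increasing-≡ (map-increasing _ (squares-increasing line₁) mono) (squares-increasing line₂) into onto
      where
      mono : ∀ {a b} → a ∈ P₁ → b ∈ P₁ → a < b → π a ∸ k < π b ∸ k
      mono a∈ b∈ a<b = let (_ , k≤πa) = ∈P₁⁻ a∈ ; (b<k , k≤πb) = ∈P₁⁻ b∈ in
        ∸-monoˡ-< (monotone a<b b<k k≤πa k≤πb) k≤πa

      into : ∀ {j} → j ∈ map (λ i → π i ∸ k) P₁ → j ∈ P₂
      into j∈ with ∈-map⁻ _ j∈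
      ... | i , i∈ , refl = ∈P₂⁺ (+-cancelˡ-< k _ _ (subst (_< k + n) (sym k+[πi∸k]≡πi′) (bounded i<N)))
                                 (subst (_< k) (sym (trans (cong π k+[πi∸k]≡πi′) (involutive i<N))) (proj₁ (∈P₁⁻ i∈)))
        where
        i<N          = <-≤-trans (proj₁ (∈P₁⁻ i∈)) (m≤m+n k n)
        k+[πi∸k]≡πi′ = k+[πi∸k]≡πi i∈

      onto : ∀ {j} → j ∈ P₂ → j ∈ map (λ i → π i ∸ k) P₁
      onto {j} j∈ = subst (_∈ map (λ i → π i ∸ k) P₁) (trans (cong (_∸ k) ππ≡) (m+n∸m≡n k j))
                      (∈-map⁺ _ (∈P₁⁺ (proj₂ (∈P₂⁻ j∈)) (subst (k ≤_) (sym ππ≡) (m≤m+n k j))))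
        where ππ≡ = involutive (+-monoʳ-< k (proj₁ (∈P₂⁻ j∈)))

    map-P₂ : map (λ j → π (k + j)) P₂ ≡ P₁
    map-P₂ = begin
      map (λ j → π (k + j)) P₂                         ≡⟨ cong (map _) (sym map-P₁) ⟩
      map (λ j → π (k + j)) (map (λ i → π i ∸ k) P₁)   ≡⟨ sym (map-∘ P₁) ⟩
      map (λ i → π (k + (π i ∸ k))) P₁                 ≡⟨ map-id-local (All.tabulate ππ≡) ⟩
      P₁                                               ∎
      where
      open ≡-Reasoning
      ππ≡ : ∀ {i} → i ∈ P₁ → π (k + (π i ∸ k)) ≡ i
      ππ≡ i∈ = trans (cong π (k+[πi∸k]≡πi i∈)) (involutive (<-≤-trans (proj₁ (∈P₁⁻ i∈)) (m≤m+n k n)))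

    #squares≡ : #squares line₁ ≡ #squares line₂
    #squares≡ = begin
      #squares line₁                            ≡⟨ sym (length-squares line₁) ⟩
      length P₁                                 ≡⟨ sym (length-map _ P₁) ⟩
      length (map (λ i → π i ∸ k) P₁)           ≡⟨ cong length map-P₁ ⟩
      length P₂                                 ≡⟨ length-squares line₂ ⟩
      #squares line₂                            ∎
      where open ≡-Reasoning

    open Encoding k line₁ line₂ using (partner; crossPartner; crossPartner-first; crossPartner-second)

    crossPartner≡π : ∀ {i} → i < k + n → ¬ SameLine k i (π i) → crossPartner i ≡ π i
    crossPartner≡π {i} i<N ¬same with position k i
    ... | first i<k = begin
      crossPartner i                     ≡⟨ crossPartner-first i<k ⟩
      k + match P₁ P₂ i                  ≡⟨ cong (λ P → k + match P₁ P i) (sym map-P₁) ⟩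
      k + match P₁ (map _ P₁) i          ≡⟨ cong (k +_) (match-map _ i∈) ⟩
      k + (π i ∸ k)                      ≡⟨ k+[πi∸k]≡πi i∈ ⟩
      π i                                ∎
      where
      open ≡-Reasoning
      i∈ = ∈P₁⁺ i<k (≮⇒≥ (λ πi<k → ¬same (inj₁ (i<k , πi<k))))
    ... | second j = begin
      crossPartner (k + j)               ≡⟨ crossPartner-second j ⟩
      match P₂ P₁ j                      ≡⟨ cong (λ P → match P₂ P j) (sym map-P₂) ⟩
      match P₂ (map _ P₂) j              ≡⟨ match-map _ j∈ ⟩
      π (k + j)                          ∎
      where
      open ≡-Reasoning
      j∈ = ∈P₂⁺ (+-cancelˡ-< k _ _ i<N) (≰⇒> (λ k≤π → ¬same (inj₂ (m+n≮m k j , ≤⇒≯ k≤π))))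

    partner≡π : ∀ {i} → i < k + n → partner i ≡ π i
    partner≡π {i} i<N with W at i in eq
    ... | dominoˡ = sym (proj₁ (opens⇒ (trans (sym (W-at i<N)) eq)))
    ... | dominoʳ = sym (cong pred (proj₁ (closes⇒ i<N (trans (sym (W-at i<N)) eq))))
    ... | square  = crossPartner≡π i<N (crosses⇒ (trans (sym (W-at i<N)) eq))

record TilingFor (m : ℕ) (c : List ℕ) (w : List Mark) : Set where
  field
    tiling          : Tiling w
    length-w        : length w ≡ m
    #squares-w      : suc (#squares w) ≡ length c
    compositionOf-w : compositionOf w ≡ c

tilingOf-tilingFor : ∀ {m c} → c ∈ oddCompositions (suc m) → TilingFor m c (tilingOf c)
tilingOf-tilingFor {m} {c} c∈ with Equivalence.to (∈-oddCompositions {suc m}) c∈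
tilingOf-tilingFor {m} {[]}      c∈ | _ , ()
tilingOf-tilingFor {m} {c₀ ∷ cs} c∈ | odds , sum≡ = record
  { tiling          = tilingOf-tiling (c₀ ∷ cs)
  ; length-w        = suc-injective (trans (length-blocks odds) sum≡)
  ; #squares-w      = #squares-blocks (c₀ ∷ cs)
  ; compositionOf-w = compositionOf-tilingOf odds
  }

compositionOf-tilingFor : ∀ {m w} → Tiling w → length w ≡ m →
                          compositionOf w ∈ oddCompositions (suc m) × TilingFor m (compositionOf w) w
compositionOf-tilingFor {m} {w} t refl =
  Equivalence.from (∈-oddCompositions {suc m}) (runs-odd 0 t , sum-runs 0 t) ,
  record { tiling = t ; length-w = refl ; #squares-w = sym (length-runs 0 t) ; compositionOf-w = refl }

module Correspondence (k n : ℕ) where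

  encode : List ℕ × List ℕ → Vec (Fin (k + n)) (k + n)
  encode (c₁ , c₂) = fromPartner (Encoding.partner k (tilingOf c₁) (tilingOf c₂))

  decode : Vec (Fin (k + n)) (k + n) → List ℕ × List ℕ
  decode v = compositionOf (Decoding.line₁ k n (partnerOf v)) , compositionOf (Decoding.line₂ k n (partnerOf v))

  EqualLengthOddPair : List ℕ × List ℕ → Set
  EqualLengthOddPair (c₁ , c₂) =
    c₁ ∈ oddCompositions (suc k) × c₂ ∈ oddCompositions (suc n) × length c₁ ≡ length c₂

  module _ {c₁ c₂ w₁ w₂} (T₁ : TilingFor k c₁ w₁) (T₂ : TilingFor n c₂ w₂)
           (equal-parts : length c₁ ≡ length c₂) where

    private
      open TilingFor
      π = Encoding.partner k w₁ w₂
      σ = partnerOf (fromPartner {k + n} π)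
      open Encoding.Properties k w₁ w₂ n (tiling T₁) (tiling T₂) (length-w T₁) (length-w T₂)
             (suc-injective (trans (#squares-w T₁) (trans equal-parts (sym (#squares-w T₂)))))

      σ≡π : ∀ {i} → i < k + n → σ i ≡ π i
      σ≡π i<N = partnerOf-fromPartner π i<N (IsNonCrossing.bounded partner-isNonCrossing i<N)

    encoding-isNonCrossing : IsNonCrossing k n σ
    encoding-isNonCrossing = IsNonCrossing-cong σ≡π partner-isNonCrossing

    decoding-lines : Decoding.line₁ k n σ ≡ w₁ × Decoding.line₂ k n σ ≡ w₂
    decoding-lines =
      applyUpTo-≡ _ w₁ (length-w T₁) (λ i<k → trans (cong (markOf k _) (σ≡π (<-≤-trans i<k (m≤m+n k n))))
                                          (trans (markOf-partner (<-≤-trans i<k (m≤m+n k n))) (W-first i<k))) ,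
      applyUpTo-≡ _ w₂ (length-w T₂) (λ j<n → trans (cong (markOf k _) (σ≡π (+-monoʳ-< k j<n)))
                                          (trans (markOf-partner (+-monoʳ-< k j<n)) (W-second _)))

    decoding-compositions : decode (fromPartner π) ≡ (c₁ , c₂)
    decoding-compositions = cong₂ _,_
      (trans (cong compositionOf (proj₁ decoding-lines)) (compositionOf-w T₁))
      (trans (cong compositionOf (proj₂ decoding-lines)) (compositionOf-w T₂))

  encode-valid : ∀ {x} → EqualLengthOddPair x → T (isValidPairing k n (encode x))
  encode-valid {c₁ , c₂} (c₁∈ , c₂∈ , equal) = Equivalence.from (T-isValidPairing _)
    (encoding-isNonCrossing (tilingOf-tilingFor c₁∈) (tilingOf-tilingFor c₂∈) equal)

  decode-encode : ∀ {x} → EqualLengthOddPair x → decode (encode x) ≡ x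
  decode-encode {c₁ , c₂} (c₁∈ , c₂∈ , equal) =
    decoding-compositions (tilingOf-tilingFor c₁∈) (tilingOf-tilingFor c₂∈) equal

  module _ {v} (valid : T (isValidPairing k n v)) where

    private
      π = partnerOf v
      open Decoding k n π
      open Properties (Equivalence.to (T-isValidPairing v) valid)
      t₁ = proj₁ tilings
      t₂ = proj₂ tilings
      decoded₁ = compositionOf-tilingFor t₁ (length-applyUpTo _ k)
      decoded₂ = compositionOf-tilingFor t₂ (length-applyUpTo _ n)

    decode-equalLengthOddPair : EqualLengthOddPair (decode v)
    decode-equalLengthOddPair = proj₁ decoded₁ , proj₁ decoded₂ ,
      trans (sym (TilingFor.#squares-w (proj₂ decoded₁)))
            (trans (cong suc #squares≡) (TilingFor.#squares-w (proj₂ decoded₂)))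

    encode-decode : encode (decode v) ≡ v
    encode-decode = begin
      encode (decode v)                             ≡⟨ cong₂ (λ u w → fromPartner (Encoding.partner k u w))
                                                         (tilingOf-compositionOf t₁) (tilingOf-compositionOf t₂) ⟩
      fromPartner (Encoding.partner k line₁ line₂)  ≡⟨ fromPartner-cong partner≡π ⟩
      fromPartner π                                 ≡⟨ fromPartner-partnerOf v ⟩
      v                                             ∎
      where open ≡-Reasoning

-- Stated for any q deciding equality of lengths, since the pattern-matching λ in pairCount
-- cannot be named.
a≡#equalLengthOddPairs : ∀ k n (q : List ℕ × List ℕ → Bool) →
  (∀ c₁ c₂ → q (c₁ , c₂) ≡ (length c₁ ≡ᵇ length c₂)) →
  a k n ≡ length (boolFilter q (cartesianProduct (oddCompositions (suc k)) (oddCompositions (suc n))))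
a≡#equalLengthOddPairs k n q q≡ = length-≡-by-inverses
  (boolFilter-unique _ (vecs-unique (k + n) (k + n)))
  (boolFilter-unique q (Unique.cartesianProduct⁺ (oddCompositions-unique (suc k)) (oddCompositions-unique (suc n))))
  decode encode
  (λ v∈ → pair⁺ (decode-equalLengthOddPair (valid v∈)))
  (λ x∈ → pairing⁺ (encode-valid (pair⁻ x∈)))
  (λ v∈ → encode-decode (valid v∈))
  (λ x∈ → decode-encode (pair⁻ x∈))
  where
  open Correspondence k n

  pairings = vecs (k + n) (k + n)
  pairs    = cartesianProduct (oddCompositions (suc k)) (oddCompositions (suc n))

  valid : ∀ {v} → v ∈ boolFilter (isValidPairing k n) pairings → T (isValidPairing k n v)
  valid v∈ = proj₂ (∈-boolFilter⁻ _ pairings v∈)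

  pairing⁺ : ∀ {v} → T (isValidPairing k n v) → v ∈ boolFilter (isValidPairing k n) pairings
  pairing⁺ = ∈-boolFilter⁺ _ pairings (∈-vecs _ _ _)

  pair⁻ : ∀ {x} → x ∈ boolFilter q pairs → EqualLengthOddPair x
  pair⁻ {c₁ , c₂} x∈ =
    let (x∈′ , t)   = ∈-boolFilter⁻ q pairs x∈
        (c₁∈ , c₂∈) = ∈-cartesianProduct⁻ _ _ x∈′
    in c₁∈ , c₂∈ , ≡ᵇ⇒≡ _ _ (subst T (q≡ c₁ c₂) t)

  pair⁺ : ∀ {x} → EqualLengthOddPair x → x ∈ boolFilter q pairs
  pair⁺ {c₁ , c₂} (c₁∈ , c₂∈ , equal) =
    ∈-boolFilter⁺ q pairs (∈-cartesianProduct⁺ c₁∈ c₂∈) (subst T (sym (q≡ c₁ c₂)) (≡⇒≡ᵇ _ _ equal))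

mainTheorem4 : (k n : ℕ) → a k n ≡ pairCount k n
mainTheorem4 k n = a≡#equalLengthOddPairs k n _ (λ _ _ → refl)
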